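{- Let $W$ be a finite Coxeter group, $s$ a simple generator, and $w\in W$ join-irreducible in the weak order with $s<w$. Then $sw$ is join-irreducible, and if $t$ is the unique cover reflection of $w$ then $sts$ is the unique cover reflection of $sw$.
   Context: $W$ finite Coxeter group with simple generators $S$ and reflections $T=\{usu^{ -1}:u\in W,s\in S\}$. Weak order: $v\le w$ iff $\ell(v)+\ell(v^{ -1}w)=\ell(w)$. An element is join-irreducible if it covers exactly one element. A cover reflection of $w$ is a reflection $t\in T$ such that $tw$ is covered by $w$ in the weak order. -}

module Defs where

open import Level using (Level; _⊔_) renaming (suc to lsuc)
open import Data.Nat using (ℕ; zero; suc; _+_; _≤_)
open import Data.Fin using (Fin)
open import Data.List using (List; []; _∷_; length)
open import Data.List.Relation.Unary.Any using (Any)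
open import Data.Product using (Σ; ∃; _×_; _,_)
open import Relation.Binary.PropositionalEquality using (_≡_; _≢_)
open import Relation.Nullary using (¬_)
open import Algebra.Bundles using (Group)
open import Algebra.Morphism.Structures using (IsGroupHomomorphism)

pow : ∀ {c ℓ} (G : Group c ℓ) → Group.Carrier G → ℕ → Group.Carrier G
pow G g zero    = Group.ε G
pow G g (suc k) = Group._∙_ G g (pow G g k)

eval : ∀ {c ℓ n} (G : Group c ℓ) → (Fin n → Group.Carrier G) → List (Fin n) → Group.Carrier G
eval G g []       = Group.ε G
eval G g (i ∷ ws) = Group._∙_ G (g i) (eval G g ws)

-- A Coxeter system (W, S) with S = {s₀,…,s_{n-1}}: a group W generated by
-- the s_i, satisfying the Coxeter relations (s_i s_j)^{m_ij} = 1 for a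
-- Coxeter matrix m, and universal among such groups (i.e. W is presented
-- by these generators and relations).  Finite Coxeter groups have all
-- m_ij finite, so entries in ℕ suffice once finiteness is assumed.
record CoxeterSystem (c ℓ : Level) (n : ℕ) : Set (lsuc (c ⊔ ℓ)) where
  field
    W      : Group c ℓ
  open Group W
  field
    m         : Fin n → Fin n → ℕ
    m-diag    : ∀ i → m i i ≡ 1
    m-sym     : ∀ i j → m i j ≡ m j i
    m-off     : ∀ i j → i ≢ j → 2 ≤ m i j
    gen       : Fin n → Carrier
    relations : ∀ i j → pow W (gen i ∙ gen j) (m i j) ≈ ε
    generated : ∀ w → ∃ λ (ws : List (Fin n)) → eval W gen ws ≈ w
    universal : (G : Group c ℓ) (g : Fin n → Group.Carrier G) →
                (∀ i j → Group._≈_ G (pow G (Group._∙_ G (g i) (g j)) (m i j)) (Group.ε G)) →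
                ∃ λ (f : Carrier → Group.Carrier G) →
                  IsGroupHomomorphism (Group.rawGroup W) (Group.rawGroup G) f
                  × (∀ i → Group._≈_ G (f (gen i)) (g i))

module Coxeter {c ℓ n} (C : CoxeterSystem c ℓ n) where
  open CoxeterSystem C
  open Group W

  IsFinite : Set (c ⊔ ℓ)
  IsFinite = ∃ λ (xs : List Carrier) → ∀ w → Any (λ x → x ≈ w) xs

  Length : Carrier → ℕ → Set ℓ
  Length w k = (∃ λ (ws : List (Fin n)) → length ws ≡ k × eval W gen ws ≈ w)
             × (∀ (ws : List (Fin n)) → eval W gen ws ≈ w → k ≤ length ws)

  _≤W_ : Carrier → Carrier → Set ℓ
  v ≤W w = ∃ λ a → ∃ λ b → ∃ λ k →
             Length v a × Length (v ⁻¹ ∙ w) b × Length w k × a + b ≡ k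

  _<W_ : Carrier → Carrier → Set ℓ
  v <W w = v ≤W w × ¬ (v ≈ w)

  Covers : Carrier → Carrier → Set (c ⊔ ℓ)
  Covers w v = v <W w × (∀ u → v <W u → ¬ (u <W w))

  JoinIrreducible : Carrier → Set (c ⊔ ℓ)
  JoinIrreducible w = ∃ λ v → Covers w v × (∀ v′ → Covers w v′ → v′ ≈ v)

  IsReflection : Carrier → Set (c ⊔ ℓ)
  IsReflection t = ∃ λ u → ∃ λ i → t ≈ (u ∙ gen i) ∙ u ⁻¹

  IsCoverReflection : Carrier → Carrier → Set (c ⊔ ℓ)
  IsCoverReflection w t = IsReflection t × Covers w (t ∙ w)

  UniqueCoverReflection : Carrier → Carrier → Set (c ⊔ ℓ)
  UniqueCoverReflection w t = IsCoverReflection w t × (∀ t′ → IsCoverReflection w t′ → t′ ≈ t)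

{-# OPTIONS --safe #-}
module Submission where

-- In the weak order, y covers v exactly when v = y sⱼ for a right descent sⱼ of y, i.e.
-- ℓ(y sⱼ) < ℓ(y).  If s is a left descent of w, every right descent sⱼ of sw is one of w,
-- since ℓ(w sⱼ) ≤ ℓ(s w sⱼ) + 1 = ℓ(w) − 1.  So every element covered by sw is s v, where v
-- is the unique element covered by w; and sw ≠ e has some right descent, so sw covers
-- exactly s v.  If t w = v, then (s t s)(s w) = s t w = s v, and right cancellation gives
-- uniqueness of the cover reflection.

open import Defs
open import Level using (Level; Lift; lift; lower)
open import Data.Bool using (Bool; true; false; _xor_)
open import Data.Bool.Properties using (xor-assoc; xor-identityˡ; xor-identityʳ; xor-same)
open import Data.Nat using (ℕ; zero; suc; _+_; _≤_; _<_; z≤n; s≤s)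
open import Data.Nat.Properties
  using (+-comm; +-suc; suc-injective; +-cancelˡ-≤; +-cancelʳ-≤; m<m+n; <⇒≱; ≤-pred; ≤-antisym; 0≢1+n)
open import Data.Fin using (Fin)
open import Data.List using (List; []; _∷_; length; _++_; [_]; initLast; _∷ʳ′_)
open import Data.List.Properties using (length-++)
open import Data.Product using (∃; ∃₂; _×_; _,_; proj₁; proj₂)
open import Data.Empty using (⊥-elim)
open import Relation.Nullary using (¬_)
open import Relation.Binary.PropositionalEquality as ≡ using (_≡_)
open import Algebra.Bundles using (Group)
open import Algebra.Morphism.Structures using (IsGroupHomomorphism)

pow-ε : ∀ {c ℓ} (G : Group c ℓ) k → Group._≈_ G (pow G (Group.ε G) k) (Group.ε G)
pow-ε G zero    = Group.refl G
pow-ε G (suc k) = Group.trans G (Group.identityˡ G _) (pow-ε G k)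

parityGroup : (c ℓ : Level) → Group c ℓ
parityGroup c ℓ = record
  { Carrier = Lift c Bool
  ; _≈_     = λ x y → Lift ℓ (lower x ≡ lower y)
  ; _∙_     = λ x y → lift (lower x xor lower y)
  ; ε       = lift false
  ; _⁻¹     = λ x → x
  ; isGroup = record
    { isMonoid = record
      { isSemigroup = record
        { isMagma = record
          { isEquivalence = record
            { refl  = lift ≡.refl
            ; sym   = λ (lift p) → lift (≡.sym p)
            ; trans = λ (lift p) (lift q) → lift (≡.trans p q)
            }
          ; ∙-cong = λ (lift p) (lift q) → lift (≡.cong₂ _xor_ p q)
          }
        ; assoc = λ x y z → lift (xor-assoc (lower x) (lower y) (lower z))
        }
      ; identity = (λ x → lift (xor-identityˡ (lower x))) , (λ x → lift (xor-identityʳ (lower x)))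
      }
    ; inverse = (λ x → lift (xor-same (lower x))) , (λ x → lift (xor-same (lower x)))
    ; ⁻¹-cong = λ p → p
    }
  }

module CoxeterProperties {c ℓ n} (C : CoxeterSystem c ℓ n) where
  open CoxeterSystem C
  open Group W
  open Coxeter C
  open import Algebra.Properties.Group W
  open import Relation.Binary.Reasoning.Setoid setoid

  ⟦_⟧ : List (Fin n) → Carrier
  ⟦_⟧ = eval W gen

  ⟦[]⟧ : ∀ i → ⟦ [ i ] ⟧ ≈ gen i
  ⟦[]⟧ i = identityʳ (gen i)

  ⟦++⟧ : ∀ us vs → ⟦ us ++ vs ⟧ ≈ ⟦ us ⟧ ∙ ⟦ vs ⟧
  ⟦++⟧ []       vs = sym (identityˡ _)
  ⟦++⟧ (u ∷ us) vs = trans (∙-congˡ (⟦++⟧ us vs)) (sym (assoc _ _ _))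

  gen-involutive : ∀ i → gen i ∙ gen i ≈ ε
  gen-involutive i =
    trans (sym (identityʳ _)) (≡.subst (λ k → pow W (gen i ∙ gen i) k ≈ ε) (m-diag i) (relations i i))

  gen⁻¹ : ∀ i → gen i ⁻¹ ≈ gen i
  gen⁻¹ i = sym (inverseˡ-unique (gen i) (gen i) (gen-involutive i))

  -- The sign character sends every generator to the non-trivial element of ℤ/2.
  gen≉ε : ∀ i → ¬ gen i ≈ ε
  gen≉ε i gen≈ε with universal (parityGroup c ℓ) (λ _ → lift true) (λ j k → pow-ε (parityGroup c ℓ) (m j k))
  ... | f , hom , f-gen
    with () ← ≡.trans (≡.sym (lower (f-gen i)))
                      (≡.trans (lower (IsGroupHomomorphism.⟦⟧-cong hom gen≈ε))
                               (lower (IsGroupHomomorphism.ε-homo hom)))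

  gen-cancelˡ : ∀ i x → gen i ∙ (gen i ∙ x) ≈ x
  gen-cancelˡ i x = trans (∙-congʳ (sym (gen⁻¹ i))) (\\-leftDividesʳ (gen i) x)

  ∙gen-transpose : ∀ {x y} i → x ∙ gen i ≈ y → x ≈ y ∙ gen i
  ∙gen-transpose {x} {y} i p = trans (x≈z//y x (gen i) y p) (∙-congˡ (gen⁻¹ i))

  ∙gen-⁻¹∙ : ∀ x i y → (x ∙ gen i) ⁻¹ ∙ y ≈ gen i ∙ (x ⁻¹ ∙ y)
  ∙gen-⁻¹∙ x i y = begin
    (x ∙ gen i) ⁻¹ ∙ y        ≈⟨ ∙-congʳ (⁻¹-anti-homo-∙ x (gen i)) ⟩
    (gen i ⁻¹ ∙ x ⁻¹) ∙ y     ≈⟨ assoc _ _ _ ⟩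
    gen i ⁻¹ ∙ (x ⁻¹ ∙ y)     ≈⟨ ∙-congʳ (gen⁻¹ i) ⟩
    gen i ∙ (x ⁻¹ ∙ y)        ∎

  ∙gen-⁻¹∙-self : ∀ x i → (x ∙ gen i) ⁻¹ ∙ x ≈ gen i
  ∙gen-⁻¹∙-self x i = trans (∙gen-⁻¹∙ x i x) (trans (∙-congˡ (inverseˡ x)) (identityʳ (gen i)))

  x⁻¹∙y≈ε⇒x≈y : ∀ {x y} → x ⁻¹ ∙ y ≈ ε → x ≈ y
  x⁻¹∙y≈ε⇒x≈y {x} {y} p = sym (trans (inverseʳ-unique (x ⁻¹) y p) (⁻¹-involutive x))

  conj-conj : ∀ x u y → (x ∙ ((u ∙ y) ∙ u ⁻¹)) ∙ x ⁻¹ ≈ ((x ∙ u) ∙ y) ∙ (x ∙ u) ⁻¹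
  conj-conj x u y = begin
    (x ∙ ((u ∙ y) ∙ u ⁻¹)) ∙ x ⁻¹   ≈⟨ ∙-congʳ (assoc x (u ∙ y) (u ⁻¹)) ⟨
    ((x ∙ (u ∙ y)) ∙ u ⁻¹) ∙ x ⁻¹   ≈⟨ assoc _ _ _ ⟩
    (x ∙ (u ∙ y)) ∙ (u ⁻¹ ∙ x ⁻¹)   ≈⟨ ∙-cong (assoc x u y) (⁻¹-anti-homo-∙ x u) ⟨
    ((x ∙ u) ∙ y) ∙ (x ∙ u) ⁻¹      ∎

  IsReflection-conj : ∀ {t} i → IsReflection t → IsReflection ((gen i ∙ t) ∙ gen i)
  IsReflection-conj {t} i (u , j , t≈) = gen i ∙ u , j , (begin
    (gen i ∙ t) ∙ gen i                         ≈⟨ ∙-cong (∙-congˡ t≈) (sym (gen⁻¹ i)) ⟩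
    (gen i ∙ ((u ∙ gen j) ∙ u ⁻¹)) ∙ gen i ⁻¹   ≈⟨ conj-conj (gen i) u (gen j) ⟩
    ((gen i ∙ u) ∙ gen j) ∙ (gen i ∙ u) ⁻¹      ∎)

  Word : Carrier → ℕ → Set ℓ
  Word x k = ∃ λ ws → length ws ≡ k × ⟦ ws ⟧ ≈ x

  Length-resp : ∀ {x y k} → x ≈ y → Length x k → Length y k
  Length-resp x≈y ((ws , len , ev) , minimal) =
    (ws , len , trans ev x≈y) , λ vs ev′ → minimal vs (trans ev′ (sym x≈y))

  Length-unique : ∀ {x k k′} → Length x k → Length x k′ → k ≡ k′
  Length-unique ((ws , ≡.refl , ev) , minimal) ((ws′ , ≡.refl , ev′) , minimal′) =
    ≤-antisym (minimal ws′ ev′) (minimal′ ws ev)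

  Length-zero : ∀ {x} → Length x 0 → x ≈ ε
  Length-zero (([] , _ , ev) , _) = sym ev

  Length-ε : Length ε 0
  Length-ε = ([] , ≡.refl , refl) , λ _ _ → z≤n

  Length-gen : ∀ i → Length (gen i) 1
  Length-gen i = ([ i ] , ≡.refl , ⟦[]⟧ i) , minimal
    where
    minimal : ∀ vs → ⟦ vs ⟧ ≈ gen i → 1 ≤ length vs
    minimal []      ev = ⊥-elim (gen≉ε i (sym ev))
    minimal (_ ∷ _) _  = s≤s z≤n

  Length-∙gen-⁻¹∙-self : ∀ x i → Length ((x ∙ gen i) ⁻¹ ∙ x) 1
  Length-∙gen-⁻¹∙-self x i = Length-resp (sym (∙gen-⁻¹∙-self x i)) (Length-gen i)

  Length-≤-split : ∀ {x y k} vs us → Length y k → ⟦ vs ⟧ ≈ x → ⟦ us ⟧ ≈ x ⁻¹ ∙ y →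
                   k ≤ length vs + length us
  Length-≤-split {x} {y} vs us (_ , minimal) ev eu =
    ≡.subst (_ ≤_) (length-++ vs) (minimal (vs ++ us) (begin
      ⟦ vs ++ us ⟧      ≈⟨ ⟦++⟧ vs us ⟩
      ⟦ vs ⟧ ∙ ⟦ us ⟧   ≈⟨ ∙-cong ev eu ⟩
      x ∙ (x ⁻¹ ∙ y)    ≈⟨ \\-leftDividesˡ x y ⟩
      y                 ∎))

  Length-split : ∀ {x y k p q} → Length y k → p + q ≡ k → Word x p → Word (x ⁻¹ ∙ y) q →
                 Length x p × Length (x ⁻¹ ∙ y) q
  Length-split ℓy ≡.refl (vs , ≡.refl , ev) (us , ≡.refl , eu) =
      ((vs , ≡.refl , ev) , λ vs′ ev′ → +-cancelʳ-≤ (length us) _ _ (Length-≤-split vs′ us ℓy ev′ eu))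
    , ((us , ≡.refl , eu) , λ us′ eu′ → +-cancelˡ-≤ (length vs) _ _ (Length-≤-split vs us′ ℓy ev eu′))

  <W⇒Length< : ∀ {x y a k} → x <W y → Length x a → Length y k → a < k
  <W⇒Length< ((_ , zero , _ , _ , ℓq , _ , _) , x≉y) _ _ = ⊥-elim (x≉y (x⁻¹∙y≈ε⇒x≈y (Length-zero ℓq)))
  <W⇒Length< ((a , suc b , k , ℓx , _ , ℓy , ≡.refl) , _) ℓx′ ℓy′
    rewrite Length-unique ℓx′ ℓx | Length-unique ℓy′ ℓy = m<m+n a (s≤s z≤n)

  Length⇒<W : ∀ {x y a b k} → Length x a → Length (x ⁻¹ ∙ y) (suc b) → Length y k → a + suc b ≡ k →
              x <W y
  Length⇒<W ℓx ℓq ℓy eq = (_ , _ , _ , ℓx , ℓq , ℓy , eq) , λ x≈y →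
    0≢1+n (Length-unique Length-ε (Length-resp (trans (∙-congʳ (⁻¹-cong x≈y)) (inverseˡ _)) ℓq))

  <W-respˡ : ∀ {v v′ w} → v ≈ v′ → v <W w → v′ <W w
  <W-respˡ v≈v′ ((a , b , k , ℓv , ℓq , ℓw , eq) , v≉w) =
      (a , b , k , Length-resp v≈v′ ℓv , Length-resp (∙-congʳ (⁻¹-cong v≈v′)) ℓq , ℓw , eq)
    , λ v′≈w → v≉w (trans v≈v′ v′≈w)

  Covers-respʳ : ∀ {w v v′} → v ≈ v′ → Covers w v → Covers w v′
  Covers-respʳ v≈v′ (v<w , maximal) =
    <W-respˡ v≈v′ v<w , λ u v′<u u<w → maximal u (<W-respˡ (sym v≈v′) v′<u) u<w

  descent⇒Covers : ∀ {y k} j → Length y (suc k) → Length (y ∙ gen j) k → Covers y (y ∙ gen j)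
  descent⇒Covers {y} {k} j ℓy ℓyj =
    Length⇒<W ℓyj (Length-∙gen-⁻¹∙-self y j) ℓy (+-comm k 1) , nothing-between
    where
    nothing-between : ∀ u → (y ∙ gen j) <W u → ¬ u <W y
    nothing-between u yj<u@((_ , _ , _ , _ , _ , ℓu , _) , _) u<y =
      <⇒≱ (<W⇒Length< yj<u ℓyj ℓu) (≤-pred (<W⇒Length< u<y ℓu ℓy))

  -- A gap of length ≥ 2 in the weak order is split by right-multiplying v with the first
  -- letter of a reduced word for v⁻¹y.
  <W-interpolate : ∀ {v y a b} → Length v a → Length (v ⁻¹ ∙ y) (suc (suc b)) →
                   Length y (a + suc (suc b)) → ∃ λ z → v <W z × z <W y
  <W-interpolate {v} {y} {a} {b} ℓv@((vs , ≡.refl , ev) , _) ((j ∷ ws , len , ew) , _) ℓy =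
    z , Length⇒<W ℓv (Length-resp (sym (\\-leftDividesʳ v (gen j))) (Length-gen j)) ℓz (+-comm a 1)
      , Length⇒<W ℓz ℓz⁻¹y ℓy (≡.sym (+-suc a (suc b)))
    where
    z : Carrier
    z = v ∙ gen j
    ⟦ws⟧ : ⟦ ws ⟧ ≈ z ⁻¹ ∙ y
    ⟦ws⟧ = begin
      ⟦ ws ⟧                       ≈⟨ gen-cancelˡ j ⟦ ws ⟧ ⟨
      gen j ∙ (gen j ∙ ⟦ ws ⟧)     ≈⟨ ∙-congˡ ew ⟩
      gen j ∙ (v ⁻¹ ∙ y)           ≈⟨ ∙gen-⁻¹∙ v j y ⟨
      z ⁻¹ ∙ y                     ∎
    ℓz,ℓz⁻¹y : Length z (suc a) × Length (z ⁻¹ ∙ y) (suc b)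
    ℓz,ℓz⁻¹y = Length-split ℓy (≡.sym (+-suc a (suc b)))
      (vs ++ [ j ] , ≡.trans (length-++ vs) (+-comm a 1) , trans (⟦++⟧ vs [ j ]) (∙-cong ev (⟦[]⟧ j)))
      (ws , suc-injective len , ⟦ws⟧)
    ℓz : Length z (suc a)
    ℓz = proj₁ ℓz,ℓz⁻¹y
    ℓz⁻¹y : Length (z ⁻¹ ∙ y) (suc b)
    ℓz⁻¹y = proj₂ ℓz,ℓz⁻¹y

  Covers⇒descent : ∀ {y v} → Covers y v →
                   ∃₂ λ j k → Length y (suc k) × Length (y ∙ gen j) k × v ≈ y ∙ gen j
  Covers⇒descent {y} {v} (((a , b , _ , ℓv , ℓq , ℓy , ≡.refl) , v≉y) , maximal) = by-gap b ℓq ℓy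
    where
    by-gap : ∀ b → Length (v ⁻¹ ∙ y) b → Length y (a + b) →
             ∃₂ λ j k → Length y (suc k) × Length (y ∙ gen j) k × v ≈ y ∙ gen j
    by-gap zero ℓq _ = ⊥-elim (v≉y (x⁻¹∙y≈ε⇒x≈y (Length-zero ℓq)))
    by-gap (suc zero) (([] , () , _) , _) _
    by-gap (suc zero) ((_ ∷ _ ∷ _ , () , _) , _) _
    by-gap (suc zero) ((j ∷ [] , _ , ej) , _) ℓy =
      j , a , ≡.subst (Length y) (+-comm a 1) ℓy , Length-resp v≈yj ℓv , v≈yj
      where
      v≈yj : v ≈ y ∙ gen j
      v≈yj = ∙gen-transpose j (trans (∙-congˡ (trans (sym (⟦[]⟧ j)) ej)) (\\-leftDividesˡ v y))
    by-gap (suc (suc b)) ℓq ℓy with z , v<z , z<y ← <W-interpolate ℓv ℓq ℓy =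
      ⊥-elim (maximal z v<z z<y)

  Length-suc⇒descent : ∀ {y k} → Length y (suc k) → ∃ λ j → Length (y ∙ gen j) k
  Length-suc⇒descent {y} {k} ℓy@((ws , len , ev) , _) with initLast ws
  ... | us ∷ʳ′ j = j , proj₁ (Length-split ℓy (+-comm k 1) (us , len-us , ⟦us⟧)
                                           ([ j ] , ≡.refl , trans (⟦[]⟧ j) (sym (∙gen-⁻¹∙-self y j))))
    where
    len-us : length us ≡ k
    len-us = suc-injective (≡.trans (+-comm 1 (length us)) (≡.trans (≡.sym (length-++ us)) len))
    ⟦us⟧ : ⟦ us ⟧ ≈ y ∙ gen j
    ⟦us⟧ = ∙gen-transpose j (trans (∙-congˡ (sym (⟦[]⟧ j))) (trans (sym (⟦++⟧ us [ j ])) ev))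

  gen<W⇒left-descent : ∀ {i w} → gen i <W w →
                       ∃ λ k → Length w (suc (suc k)) × Length (gen i ∙ w) (suc k)
  gen<W⇒left-descent {i} ((_ , zero , _ , _ , ℓq , _ , _) , s≉w) =
    ⊥-elim (s≉w (x⁻¹∙y≈ε⇒x≈y (Length-zero ℓq)))
  gen<W⇒left-descent {i} {w} ((a , suc k , _ , ℓs , ℓq , ℓw , ≡.refl) , _) =
    k , ≡.subst (λ a → Length w (a + suc k)) (Length-unique ℓs (Length-gen i)) ℓw
      , Length-resp (∙-congʳ (gen⁻¹ i)) ℓq

  descent-transfer : ∀ {w k} i j → Length w (suc (suc k)) → Length ((gen i ∙ w) ∙ gen j) k →
                     Length (w ∙ gen j) (suc k)
  descent-transfer {w} {k} i j ℓw ((vs , len , ev) , _) =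
    proj₁ (Length-split ℓw (≡.cong suc (+-comm k 1)) (i ∷ vs , ≡.cong suc len , ⟦i∷vs⟧)
                        ([ j ] , ≡.refl , trans (⟦[]⟧ j) (sym (∙gen-⁻¹∙-self w j))))
    where
    ⟦i∷vs⟧ : gen i ∙ ⟦ vs ⟧ ≈ w ∙ gen j
    ⟦i∷vs⟧ = begin
      gen i ∙ ⟦ vs ⟧                   ≈⟨ ∙-congˡ ev ⟩
      gen i ∙ ((gen i ∙ w) ∙ gen j)    ≈⟨ ∙-congˡ (assoc _ _ _) ⟩
      gen i ∙ (gen i ∙ (w ∙ gen j))    ≈⟨ gen-cancelˡ i _ ⟩
      w ∙ gen j                        ∎

  module _ {i w v₀} (s<w : gen i <W w) (covers-unique : ∀ v → Covers w v → v ≈ v₀) where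
    private
      k : ℕ
      k = proj₁ (gen<W⇒left-descent s<w)
      ℓw : Length w (suc (suc k))
      ℓw = proj₁ (proj₂ (gen<W⇒left-descent s<w))
      ℓsw : Length (gen i ∙ w) (suc k)
      ℓsw = proj₂ (proj₂ (gen<W⇒left-descent s<w))

    Covers-gen∙-unique : ∀ v → Covers (gen i ∙ w) v → v ≈ gen i ∙ v₀
    Covers-gen∙-unique v sw⋗v with j , k′ , ℓsw′ , ℓswj , v≈swj ← Covers⇒descent sw⋗v = begin
      v                    ≈⟨ v≈swj ⟩
      (gen i ∙ w) ∙ gen j  ≈⟨ assoc _ _ _ ⟩
      gen i ∙ (w ∙ gen j)  ≈⟨ ∙-congˡ (covers-unique _ (descent⇒Covers j ℓw (descent-transfer i j ℓw ℓswj′))) ⟩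
      gen i ∙ v₀           ∎
      where
      ℓswj′ : Length ((gen i ∙ w) ∙ gen j) k
      ℓswj′ = ≡.subst (Length _) (suc-injective (Length-unique ℓsw′ ℓsw)) ℓswj

    Covers-gen∙ : Covers (gen i ∙ w) (gen i ∙ v₀)
    Covers-gen∙ with j , ℓswj ← Length-suc⇒descent ℓsw =
      Covers-respʳ (Covers-gen∙-unique _ sw⋗swj) sw⋗swj
      where
      sw⋗swj : Covers (gen i ∙ w) ((gen i ∙ w) ∙ gen j)
      sw⋗swj = descent⇒Covers j ℓsw ℓswj

    UniqueCoverReflection-conj : ∀ t → UniqueCoverReflection w t →
                                 UniqueCoverReflection (gen i ∙ w) ((gen i ∙ t) ∙ gen i)
    UniqueCoverReflection-conj t ((t-refl , w⋗tw) , _) =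
        (IsReflection-conj i t-refl , Covers-respʳ (sym sts∙sw≈sv₀) Covers-gen∙)
      , λ t′ (_ , sw⋗t′sw) → ∙-cancelʳ (gen i ∙ w) t′ _ (trans (Covers-gen∙-unique _ sw⋗t′sw) (sym sts∙sw≈sv₀))
      where
      sts∙sw≈sv₀ : ((gen i ∙ t) ∙ gen i) ∙ (gen i ∙ w) ≈ gen i ∙ v₀
      sts∙sw≈sv₀ = begin
        ((gen i ∙ t) ∙ gen i) ∙ (gen i ∙ w)   ≈⟨ assoc _ _ _ ⟩
        (gen i ∙ t) ∙ (gen i ∙ (gen i ∙ w))   ≈⟨ ∙-congˡ (gen-cancelˡ i w) ⟩
        (gen i ∙ t) ∙ w                       ≈⟨ assoc _ _ _ ⟩
        gen i ∙ (t ∙ w)                       ≈⟨ ∙-congˡ (covers-unique _ w⋗tw) ⟩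
        gen i ∙ v₀                            ∎

lemma2p3 : ∀ {c ℓ n} (C : CoxeterSystem c ℓ n) → Coxeter.IsFinite C →
    (i : Fin n) (w : Group.Carrier (CoxeterSystem.W C)) →
    Coxeter.JoinIrreducible C w →
    Coxeter._<W_ C (CoxeterSystem.gen C i) w →
    Coxeter.JoinIrreducible C (Group._∙_ (CoxeterSystem.W C) (CoxeterSystem.gen C i) w)
    × (∀ t → Coxeter.UniqueCoverReflection C w t →
         Coxeter.UniqueCoverReflection C
           (Group._∙_ (CoxeterSystem.W C) (CoxeterSystem.gen C i) w)
           (Group._∙_ (CoxeterSystem.W C)
             (Group._∙_ (CoxeterSystem.W C) (CoxeterSystem.gen C i) t)
             (CoxeterSystem.gen C i)))
lemma2p3 C _ i w (v₀ , _ , covers-unique) s<w =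
    (gen i ∙ v₀ , Covers-gen∙ s<w covers-unique , Covers-gen∙-unique s<w covers-unique)
  , UniqueCoverReflection-conj s<w covers-unique
  where
  open CoxeterSystem C
  open Group W
  open CoxeterProperties C
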